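{- Let $\pi$ be a permutation of $\{1,\dots,n\}$. If $\pi$ can be sorted on a deque, then $\pi$ can be sorted on a deque by a reduced run.
   Context: Sorting on a deque: a state consists of three lists, the output, the deque and the input. Initially the output and deque are empty and the input is $\pi=\pi_1\pi_2\cdots\pi_n$. The allowed operations are: (a) remove the first element of the input and put it at the left end of the deque; (b) remove the first element of the input and put it at the right end of the deque; (y) remove the left end element of a nonempty deque and append it to the end of the output; (z) remove the right end element of a nonempty deque and append it to the end of the output. A run is a sequence of states, each obtained from the previous one by one of these operations, starting from the initial state. A run is successful if after $2n$ steps the output is $1,2,\dots,n$; $\pi$ is sortable on a deque if a successful run exists. At a given state, the next element required by the output is $t+1$, where $t$ is the number of elements in the output. A run is reduced if every state of the run in which an element $i$ located at one of the two ends of the deque is the next element required by the output is followed (in the run) by a state in which that element $i$ has been removed from the deque and moved to the output. -}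

module Defs where

open import Data.Nat using (ℕ; suc; _*_)
open import Data.List using (List; []; _∷_; _++_; [_]; length; map; upTo)
open import Data.Product using (Σ; ∃; _×_; _,_)
open import Data.Sum using (_⊎_)
open import Data.Unit using (⊤)
open import Relation.Binary.PropositionalEquality using (_≡_)

-- A state: output, deque, input.  The deque is a list whose head is the
-- LEFT end and whose last element is the RIGHT end.
record State : Set where
  constructor st
  field
    output : List ℕ
    deque  : List ℕ
    input  : List ℕ
open State public

initial : List ℕ → State
initial π = st [] [] π

data Step : State → State → Set where
  op-a : ∀ {o d x xs} → Step (st o d (x ∷ xs)) (st o (x ∷ d) xs)
  op-b : ∀ {o d x xs} → Step (st o d (x ∷ xs)) (st o (d ++ [ x ]) xs)
  op-y : ∀ {o d x i}  → Step (st o (x ∷ d) i) (st (o ++ [ x ]) d i)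
  op-z : ∀ {o d x i}  → Step (st o (d ++ [ x ]) i) (st (o ++ [ x ]) d i)

data Run : State → State → Set where
  done : ∀ {s} → Run s s
  step : ∀ {s s₁ s₂} → Step s s₁ → Run s₁ s₂ → Run s s₂

steps : ∀ {s s'} → Run s s' → ℕ
steps done       = 0
steps (step _ r) = suc (steps r)

next : State → ℕ
next s = suc (length (output s))

AtEnd : ℕ → List ℕ → Set
AtEnd i d = (∃ λ d' → d ≡ i ∷ d') ⊎ (∃ λ d' → d ≡ d' ++ [ i ])

Reduced : ∀ {s s'} → Run s s' → Set
Reduced done = ⊤
Reduced (step {s} {s₁} _ r) =
  (AtEnd (next s) (deque s) →
     output s₁ ≡ output s ++ [ next s ])
  × Reduced r

oneTo : ℕ → List ℕ
oneTo n = map suc (upTo n)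

Successful : (π : List ℕ) → ∀ {s} → Run (initial π) s → Set
Successful π {s} r = (steps r ≡ 2 * length π) × (output s ≡ oneTo (length π))

SortableOnDeque : List ℕ → Set
SortableOnDeque π = Σ State λ s → Σ (Run (initial π) s) λ r → Successful π r

-- Write  contents s = output ++ deque ++ input.  Every operation only
-- rearranges the contents, so along a run starting from a permutation of
-- 1, …, n the contents stay a permutation of 1, …, n; in particular all
-- entries are distinct.  Now take a successful run and a state s in it in
-- which the next required element i sits at an end of the deque.  Since the
-- final output is 1, …, n, the element i is the first one output after s,
-- and as i is not in the input, no element pushed before that moment can
-- cover it.  Hence popping i first and then replaying the remaining steps
-- (with the pop of i omitted) yields a run with the same final state and
-- the same length ("pop-first").  Applying this exchange at every state
-- where reducedness fails, by induction on the length of the run, turns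
-- any successful run into a reduced one of the same length.

module Submission where

open import Defs
open import Data.Nat using (ℕ; zero; suc; _≟_)
open import Data.Nat.Properties using (suc-injective)
open import Data.List using (List; []; _∷_; _++_; [_]; length; applyUpTo; initLast; _∷ʳ′_)
open import Data.List.Properties
  using (++-assoc; ++-identityʳ; ++-identityʳ-unique; ++-cancelˡ; ∷-injective; ∷-injectiveˡ; ∷-injectiveʳ; ∷ʳ-injectiveʳ; map-upTo; length-applyUpTo)
open import Data.List.Membership.Propositional using (_∈_; _∉_)
open import Data.List.Membership.Propositional.Properties using (∈-++⁺ˡ; ∈-++⁺ʳ)
open import Data.List.Relation.Unary.Any using (here; there)
open import Data.List.Relation.Unary.All using (lookup)
open import Data.List.Relation.Unary.All.Properties using (++⁻ʳ)
open import Data.List.Relation.Unary.AllPairs using (_∷_)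
open import Data.List.Relation.Unary.Unique.Propositional using (Unique)
open import Data.List.Relation.Unary.Unique.Propositional.Properties using (map⁺; upTo⁺)
open import Data.List.Relation.Binary.Permutation.Propositional using (_↭_; ↭-sym; ↭-trans; ↭-reflexive; ↭⇒↭ₛ)
open import Data.List.Relation.Binary.Permutation.Propositional.Properties using (↭-length; ∈-resp-↭; shift; ++⁺ˡ; drop-mid)
open import Data.List.Relation.Binary.Permutation.Setoid.Properties as Permₛ using ()
open import Data.Product using (Σ; ∃; _×_; _,_)
open import Data.Sum using (_⊎_; inj₁; inj₂)
open import Data.Unit using (tt)
open import Data.Empty using (⊥-elim)
open import Function using (_∘_)
open import Relation.Nullary using (Dec; yes; no; contradiction)
open import Relation.Nullary.Decidable using (_⊎-dec_)
open import Relation.Binary.PropositionalEquality using (_≡_; _≢_; refl; sym; trans; cong; subst; setoid)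

Unique-resp-↭ : ∀ {A : Set} {xs ys : List A} → xs ↭ ys → Unique xs → Unique ys
Unique-resp-↭ {A} p = Permₛ.Unique-resp-↭ (setoid A) (↭⇒↭ₛ p)

↭-cancelˡ : ∀ {A : Set} (xs : List A) {ys zs} → xs ++ ys ↭ xs ++ zs → ys ↭ zs
↭-cancelˡ []       p = p
↭-cancelˡ (x ∷ xs) p = ↭-cancelˡ xs (drop-mid [] [] p)

unique-disjoint : ∀ {A : Set} (xs : List A) {ys x} → Unique (xs ++ ys) → x ∈ xs → x ∉ ys
unique-disjoint (x ∷ xs) (x∉ ∷ _) (here refl) x∈ys = lookup (++⁻ʳ xs x∉) x∈ys refl
unique-disjoint (_ ∷ xs) (_ ∷ u)  (there x∈)  x∈ys = unique-disjoint xs u x∈ x∈ys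

applyUpTo-entry : ∀ {A : Set} (f : ℕ → A) n (xs : List A) {x ys} →
  xs ++ x ∷ ys ≡ applyUpTo f n → x ≡ f (length xs)
applyUpTo-entry f zero    []       ()
applyUpTo-entry f zero    (_ ∷ _)  ()
applyUpTo-entry f (suc n) []       eq = ∷-injectiveˡ eq
applyUpTo-entry f (suc n) (_ ∷ xs) eq = applyUpTo-entry (f ∘ suc) n xs (∷-injectiveʳ eq)

oneTo-entry : ∀ n (xs : List ℕ) {x ys} → xs ++ x ∷ ys ≡ oneTo n → x ≡ suc (length xs)
oneTo-entry n xs eq = applyUpTo-entry suc n xs (trans eq (map-upTo suc n))

length-oneTo : ∀ n → length (oneTo n) ≡ n
length-oneTo n = trans (cong length (map-upTo suc n)) (length-applyUpTo suc n)

length-↭-oneTo : ∀ {π n} → π ↭ oneTo n → length π ≡ n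
length-↭-oneTo {n = n} π↭ = trans (↭-length π↭) (length-oneTo n)

Unique-oneTo : ∀ n → Unique (oneTo n)
Unique-oneTo n = map⁺ suc-injective (upTo⁺ n)

AtEnd⇒∈ : ∀ {i d} → AtEnd i d → i ∈ d
AtEnd⇒∈ (inj₁ (_  , refl)) = here refl
AtEnd⇒∈ (inj₂ (d′ , refl)) = ∈-++⁺ʳ d′ (here refl)

atLeft? : ∀ i (d : List ℕ) → Dec (∃ λ d′ → d ≡ i ∷ d′)
atLeft? i []      = no λ { (_ , ()) }
atLeft? i (y ∷ d) with i ≟ y
... | yes refl = yes (d , refl)
... | no  i≢y  = no λ { (_ , eq) → i≢y (sym (∷-injectiveˡ eq)) }

atRight? : ∀ i (d : List ℕ) → Dec (∃ λ d′ → d ≡ d′ ++ [ i ])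
atRight? i d with initLast d
... | []       = no λ { ([] , ()) ; (_ ∷ _ , ()) }
... | d′ ∷ʳ′ y with i ≟ y
...   | yes refl = yes (d′ , refl)
...   | no  i≢y  = no λ { (d″ , eq) → i≢y (sym (∷ʳ-injectiveʳ d′ d″ eq)) }

AtEnd? : ∀ i d → Dec (AtEnd i d)
AtEnd? i d = atLeft? i d ⊎-dec atRight? i d

contents : State → List ℕ
contents s = output s ++ deque s ++ input s

step-grows : ∀ {s s₁} → Step s s₁ → ∃ λ L → output s₁ ≡ output s ++ L
step-grows (op-a {o}) = [] , sym (++-identityʳ o)
step-grows (op-b {o}) = [] , sym (++-identityʳ o)
step-grows (op-y {x = x}) = [ x ] , refl
step-grows (op-z {x = x}) = [ x ] , refl

output-grows : ∀ {s sf} → Run s sf → ∃ λ L → output sf ≡ output s ++ L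
output-grows {s} done = [] , sym (++-identityʳ (output s))
output-grows {s} (step stp r) with L₁ , eq₁ ← step-grows stp | L₂ , eq₂ ← output-grows r =
  L₁ ++ L₂ , trans eq₂ (trans (cong (_++ L₂) eq₁) (++-assoc (output s) L₁ L₂))

step-↭ : ∀ {s s₁} → Step s s₁ → contents s₁ ↭ contents s
step-↭ (op-a {o} {d} {x} {xs}) = ++⁺ˡ o (↭-sym (shift x d xs))
step-↭ (op-b {o} {d} {x} {xs}) = ↭-reflexive (cong (o ++_) (++-assoc d [ x ] xs))
step-↭ (op-y {o} {d} {x} {i}) = ↭-reflexive (++-assoc o [ x ] (d ++ i))
step-↭ (op-z {o} {d} {x} {i}) =
  ↭-trans (↭-reflexive (++-assoc o [ x ] (d ++ i)))
          (++⁺ˡ o (↭-trans (↭-sym (shift x d i)) (↭-reflexive (sym (++-assoc d [ x ] i)))))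

Pops : ℕ → List ℕ → List ℕ → Set
Pops i d e = (d ≡ i ∷ e) ⊎ (d ≡ e ++ [ i ])

pop : ∀ {o i d e inp} → Pops i d e → Step (st o d inp) (st (o ++ [ i ]) e inp)
pop (inj₁ refl) = op-y
pop (inj₂ refl) = op-z

pop-past-left : ∀ {i x d e₁} → x ≢ i → Pops i (x ∷ d) e₁ → ∃ λ e → Pops i d e × e₁ ≡ x ∷ e
pop-past-left x≢i (inj₁ eq) = contradiction (∷-injectiveˡ eq) x≢i
pop-past-left {e₁ = []}    x≢i (inj₂ eq) = contradiction (∷-injectiveˡ eq) x≢i
pop-past-left {e₁ = _ ∷ e} x≢i (inj₂ eq) with refl , refl ← ∷-injective eq = e , inj₂ refl , refl

pop-past-right : ∀ {i x d e₁} → x ≢ i → Pops i (d ++ [ x ]) e₁ → ∃ λ e → Pops i d e × e₁ ≡ e ++ [ x ]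
pop-past-right {d = d} x≢i (inj₂ eq) = contradiction (∷ʳ-injectiveʳ d _ eq) x≢i
pop-past-right {d = []}     x≢i (inj₁ eq) = contradiction (∷-injectiveˡ eq) x≢i
pop-past-right {d = _ ∷ d′} x≢i (inj₁ eq) with refl , refl ← ∷-injective eq = d′ , inj₁ refl , refl

first-popped : ∀ (o : List ℕ) {x i L L₁} → (o ++ [ x ]) ++ L₁ ≡ o ++ i ∷ L → x ≡ i
first-popped o {x} {L₁ = L₁} eq = ∷-injectiveˡ (++-cancelˡ o _ _ (trans (sym (++-assoc o [ x ] L₁)) eq))

pop-first : ∀ {o d inp sf} i L (r : Run (st o d inp) sf) →
  output sf ≡ o ++ i ∷ L → i ∉ inp →
  Σ (List ℕ) λ e → Pops i d e ×
    Σ (Run (st (o ++ [ i ]) e inp) sf) λ r′ → suc (steps r′) ≡ steps r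
pop-first {o} i L done out≡ i∉ = contradiction (++-identityʳ-unique o out≡) λ ()
pop-first i L (step op-a r) out≡ i∉
  with e₁ , pops₁ , r′ , len ← pop-first i L r out≡ (i∉ ∘ there)
  with e , pops , refl ← pop-past-left (λ x≡i → i∉ (here (sym x≡i))) pops₁ =
  e , pops , step op-a r′ , cong suc len
pop-first i L (step op-b r) out≡ i∉
  with e₁ , pops₁ , r′ , len ← pop-first i L r out≡ (i∉ ∘ there)
  with e , pops , refl ← pop-past-right (λ x≡i → i∉ (here (sym x≡i))) pops₁ =
  e , pops , step op-b r′ , cong suc len
pop-first {o} i L (step op-y r) out≡ i∉ with L₁ , grown ← output-grows r
  with refl ← first-popped o (trans (sym grown) out≡) = _ , inj₁ refl , r , refl
pop-first {o} i L (step op-z r) out≡ i∉ with L₁ , grown ← output-grows r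
  with refl ← first-popped o (trans (sym grown) out≡) = _ , inj₂ refl , r , refl

next-emitted : ∀ {n} o {rest L x} → o ++ rest ↭ oneTo n → o ++ L ≡ oneTo n →
  x ∈ rest → ∃ λ L′ → L ≡ suc (length o) ∷ L′
next-emitted o {L = []} c↭ out≡ x∈ =
  contradiction (∈-resp-↭ (↭-cancelˡ o (↭-trans c↭ (↭-reflexive (sym out≡)))) x∈) λ ()
next-emitted {n} o {L = y ∷ L′} c↭ out≡ x∈ with refl ← oneTo-entry n o out≡ = L′ , refl

next-not-in-input : ∀ {n s} → contents s ↭ oneTo n → AtEnd (next s) (deque s) →
  next s ∉ input s
next-not-in-input {n} {st o d inp} c↭ at =
  unique-disjoint (o ++ d)
    (subst Unique (sym (++-assoc o d inp)) (Unique-resp-↭ (↭-sym c↭) (Unique-oneTo n)))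
    (∈-++⁺ʳ o (AtEnd⇒∈ at))

-- The recursion is on the length k: if
-- the next element is not at an end of the deque the first step is kept,
-- otherwise it is replaced by popping the next element (pop-first).
reduce : ∀ {n} k {s sf} (r : Run s sf) → steps r ≡ k → contents s ↭ oneTo n →
  output sf ≡ oneTo n → Σ (Run s sf) λ r′ → (steps r′ ≡ steps r) × Reduced r′
reduce k done _ _ _ = done , refl , tt
reduce (suc k) {s@(st o d inp)} (step stp r) len c↭ final with AtEnd? (next s) d
... | no ¬at with r′ , len′ , red ← reduce k r (suc-injective len) (↭-trans (step-↭ stp) c↭) final =
  step stp r′ , cong suc len′ , ⊥-elim ∘ ¬at , red
... | yes at
  with L , grown ← output-grows (step stp r)
  with L′ , refl ← next-emitted o c↭ (trans (sym grown) final) (∈-++⁺ˡ (AtEnd⇒∈ at))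
  with e , pops , r″ , len″ ← pop-first (next s) L′ (step stp r) grown (next-not-in-input {s = s} c↭ at)
  with r‴ , len‴ , red ← reduce k r″ (suc-injective (trans len″ len))
                                    (↭-trans (step-↭ (pop {o} {inp = inp} pops)) c↭) final =
  step (pop pops) r‴ , trans (cong suc len‴) len″ , (λ _ → refl) , red

lemma5p1 : (n : ℕ) (π : List ℕ) → π ↭ oneTo n → SortableOnDeque π →
    Σ State λ s → Σ (Run (initial π) s) λ r → Successful π r × Reduced r
lemma5p1 n π π↭ (s , r , len , sorted)
  with r′ , same-len , red ← reduce (steps r) r refl π↭ (trans sorted (cong oneTo (length-↭-oneTo π↭))) =
  s , r′ , (trans same-len len , sorted) , red
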